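{- In the standing setup of the context, if $G$ has an edge between two small vertices, then every small vertex $v$ has at least $\min(\ell+1,\deg v)$ edges (counted with multiplicity) to vertices in $L\cup\{u_1\}$.
   Context: Loop-free multigraph: finite undirected graph without loops, multiple edges between distinct vertices allowed. The type of an edge joining $u,v$ is $\{u,v\}$; its multiplicity is the number of edges of that type; an edge/type is simple if its multiplicity is one and non-simple if at least two; a graph is simple if all edges are simple. Two vertices are adjacent if there is at least one edge between them. Double edge swap $(a_1,a_2)(a_3,a_4)$: remove two distinct edges of types $\{a_1,a_2\},\{a_3,a_4\}$ and add edges of types $\{a_2,a_3\},\{a_4,a_1\}$; admissible if the removed edges share no endpoint and not both are simple. Orders: fix finite $V$ and $d:V\to\mathbb{N}$, and a total order $<$ on $V$ with $d(u)<d(v)\Rightarrow u<v$. For $u_1>u_2$, $v_1>v_2$ set $\{u_1,u_2\}\le\{v_1,v_2\}$ iff $u_1<v_1$ or ($u_1=v_1$ and $u_2\le v_2$). For loop-free multigraphs on $V$ with degrees $d$: $G'<G$ iff $G$ is not simple and either the maximal non-simple type of $G$ is larger than all non-simple types of $G'$, or the maximal non-simple types of $G'$ and $G$ coincide and its multiplicity is strictly larger in $G$ than in $G'$. Standing setup: $G$ is a non-simple loop-free multigraph on $V$ with $\deg_G v=d(v)$ for all $v$, such that no finite sequence of admissible double edge swaps transforms $G$ into a graph $G'$ with $G'<G$. Let $\{u_1,u_2\}$, $u_1>u_2$, be the maximal non-simple type of $G$. Vertices other than $u_1,u_2$ are ordinary. For $i=1,2$, $V_i$ is the set of ordinary vertices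 adjacent to $u_i$ and $\overline{V_i}$ the set of ordinary vertices not adjacent to $u_i$. An ordinary vertex is small if it is smaller than $u_1$ and large if it is larger than $u_1$. $L$ denotes the set of large vertices and $\ell=|L|$; $\deg v$ is the degree of $v$ in $G$. -}

module Defs where

open import Data.Nat using (ℕ; zero; suc; _+_; _∸_; _≤_; _<_; _⊔_; _⊓_)
open import Data.Fin using (Fin; _≟_) renaming (_<_ to _<ᶠ_; _≤_ to _≤ᶠ_)
open import Data.Fin.Properties using () renaming (_<?_ to _<ᶠ?_; _≤?_ to _≤ᶠ?_)
open import Data.List using (List; map; filter; length; allFin)
open import Data.Nat.ListAction using (sum)
open import Data.Bool using (Bool; true; false; if_then_else_; _∧_; _∨_)
open import Data.Product using (Σ; ∃; _×_; _,_)
open import Data.Sum using (_⊎_)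
open import Relation.Nullary using (¬_; does)
open import Relation.Binary.PropositionalEquality using (_≡_; _≢_)
open import Relation.Binary.Construct.Closure.ReflexiveTransitive using (Star)

-- A loop-free multigraph on the vertex set Fin n is given by its multiplicity
-- function: m x y = number of edges of type {x,y}.
-- The total order on V is the natural order on Fin n.
Mult : ℕ → Set
Mult n = Fin n → Fin n → ℕ

IsMultigraph : ∀ {n} → Mult n → Set
IsMultigraph {n} m = (∀ x y → m x y ≡ m y x) × (∀ x → m x x ≡ 0)

Σv : ∀ {n} → (Fin n → ℕ) → ℕ
Σv {n} f = sum (map f (allFin n))

deg : ∀ {n} → Mult n → Fin n → ℕ
deg m v = Σv (m v)

ind : ∀ {n} → Fin n → Fin n → Fin n → Fin n → ℕ
ind a b x y =
  if (does (x ≟ a) ∧ does (y ≟ b)) ∨ (does (x ≟ b) ∧ does (y ≟ a)) then 1 else 0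

-- result of the double edge swap (a1,a2)(a3,a4): remove one edge of type
-- {a1,a2} and one of type {a3,a4}, add edges of types {a2,a3} and {a4,a1}
swapG : ∀ {n} → Fin n → Fin n → Fin n → Fin n → Mult n → Mult n
swapG a1 a2 a3 a4 m x y =
  ((m x y ∸ ind a1 a2 x y) ∸ ind a3 a4 x y) + ind a2 a3 x y + ind a4 a1 x y

AdmSwap : ∀ {n} → Mult n → Mult n → Set
AdmSwap {n} m m' = Σ (Fin n) λ a1 → Σ (Fin n) λ a2 → Σ (Fin n) λ a3 → Σ (Fin n) λ a4 →
  (1 ≤ m a1 a2) × (1 ≤ m a3 a4) ×
  (a1 ≢ a2) × (a3 ≢ a4) × (a1 ≢ a3) × (a1 ≢ a4) × (a2 ≢ a3) × (a2 ≢ a4) ×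
  (2 ≤ m a1 a2 ⊎ 2 ≤ m a3 a4) ×
  (∀ x y → m' x y ≡ swapG a1 a2 a3 a4 m x y)

Reach : ∀ {n} → Mult n → Mult n → Set
Reach = Star AdmSwap

-- order on types {x,y} (x>y) vs {a,b} (a>b)
TypeLe : ∀ {n} → Fin n → Fin n → Fin n → Fin n → Set
TypeLe x y a b = x <ᶠ a ⊎ (x ≡ a × y ≤ᶠ b)

TypeLt : ∀ {n} → Fin n → Fin n → Fin n → Fin n → Set
TypeLt x y a b = x <ᶠ a ⊎ (x ≡ a × y <ᶠ b)

IsMaxNonSimple : ∀ {n} → Mult n → Fin n → Fin n → Set
IsMaxNonSimple m a b =
  (b <ᶠ a) × (2 ≤ m a b) × (∀ x y → y <ᶠ x → 2 ≤ m x y → TypeLe x y a b)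

LessG : ∀ {n} → Mult n → Mult n → Set
LessG {n} m' m = Σ (Fin n) λ a → Σ (Fin n) λ b → IsMaxNonSimple m a b ×
  ((∀ x y → y <ᶠ x → 2 ≤ m' x y → TypeLt x y a b)
   ⊎ (IsMaxNonSimple m' a b × m' a b < m a b))

DegCompatible : ∀ {n} → Mult n → Set
DegCompatible {n} m = ∀ (u v : Fin n) → deg m u < deg m v → u <ᶠ v

Small : ∀ {n} → Fin n → Fin n → Fin n → Set
Small u1 u2 v = (v ≢ u1) × (v ≢ u2) × (v <ᶠ u1)

-- ℓ = number of large vertices (ordinary and larger than u1; note u2 < u1)
ell : ∀ {n} → Fin n → ℕ
ell {n} u1 = length (filter (u1 <ᶠ?_) (allFin n))

edgesToLu1 : ∀ {n} → Mult n → Fin n → Fin n → ℕ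
edgesToLu1 {n} m u1 v = sum (map (m v) (filter (u1 ≤ᶠ?_) (allFin n)))

-- Suppose a small vertex v had fewer than min(ℓ+1, deg v) edges into L ∪ {u1}.  Then v has a
-- neighbour w < u1, and some z ≥ u1 is not adjacent to v.  In every resulting configuration we
-- exhibit at most three admissible swaps, the first one removing a copy of u1u2, after which the
-- multiplicity of {u1,u2} has dropped while every type above {u1,u2} is still simple: a graph
-- smaller than G, contradicting minimality.  The small edge xy provides the first swap
-- (u1,u2)(x,y), which makes {u1,y} non-simple.  If v is adjacent to u1 then z > u1, and degree
-- compatibility (deg z ≥ deg u1) yields a neighbour t of z not adjacent to u1; the edge zt is the
-- last one swapped.

module Submission where

open import Defs
open import Data.Nat using (ℕ; zero; suc; _+_; _∸_; _≤_; _<_; _⊓_; z≤n; s≤s) renaming (_≟_ to _≟ℕ_)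
open import Data.Nat.Properties hiding (_≟_; <-cmp; ≤∧≢⇒<; <⇒≢)
open import Data.Nat.ListAction using (sum)
open import Data.Nat.Solver using (module +-*-Solver)
open import Algebra.Properties.CommutativeSemigroup +-commutativeSemigroup using (interchange)
open import Data.Fin using (Fin; zero; suc; _≟_) renaming (_<_ to _<ᶠ_; _≤_ to _≤ᶠ_)
open import Data.Fin.Properties using (<-cmp; ≤∧≢⇒<; any?; <⇒≢) renaming (_<?_ to _<ᶠ?_; _≤?_ to _≤ᶠ?_)
open import Data.List using ([]; _∷_; map; filter; length; allFin)
open import Data.List.Properties using (map-tabulate)
open import Data.List.Membership.Propositional using (_∈_)
open import Data.List.Membership.Propositional.Properties using (∈-allFin)
open import Data.List.Relation.Unary.Any using (here; there)
open import Data.List.Relation.Unary.All as All using (All; []; _∷_)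
open import Data.List.Relation.Unary.All.Properties using (all-filter)
open import Data.Bool using (if_then_else_)
open import Data.Empty using (⊥)
open import Data.Product using (Σ; _×_; _,_; proj₁; proj₂)
open import Data.Sum using (_⊎_; inj₁; inj₂)
open import Function using (_∘_; id)
open import Function.Bundles using (_⇔_; mk⇔; Equivalence)
open import Level using (0ℓ)
open import Relation.Nullary using (¬_; Dec; yes; no; does; contradiction)
open import Relation.Nullary.Decidable using (¬?; _×-dec_; _⊎-dec_; dec-true; dec-false)
open import Relation.Unary using (Pred; Decidable; _⊆_)
open import Relation.Binary.Definitions using (tri<; tri≈; tri>)
open import Relation.Binary.PropositionalEquality
open import Relation.Binary.Construct.Closure.ReflexiveTransitive using (ε; _◅_)

+-telescope : ∀ {a b c e f} → a + e ≤ b + f → b ≤ c + e → a ≤ c + f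
+-telescope {a} {b} {c} {e} {f} ae≤bf b≤ce = +-cancelʳ-≤ e a (c + f) (begin
  a + e        ≤⟨ ae≤bf ⟩
  b + f        ≤⟨ +-monoˡ-≤ f b≤ce ⟩
  c + e + f    ≡⟨ +-assoc c e f ⟩
  c + (e + f)  ≡⟨ cong (c +_) (+-comm e f) ⟩
  c + (f + e)  ≡⟨ +-assoc c f e ⟨
  c + f + e    ∎)
  where open ≤-Reasoning

-- Finite sums

module _ {A : Set} {P Q : Pred A 0ℓ} (P? : Decidable P) (Q? : Decidable Q) (P⊆Q : P ⊆ Q) where

  length-filter-⊆ : ∀ xs → length (filter P? xs) ≤ length (filter Q? xs)
  length-filter-⊆ [] = z≤n
  length-filter-⊆ (x ∷ xs) with P? x | Q? x
  ... | yes _ | yes _ = s≤s (length-filter-⊆ xs)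
  ... | yes p | no ¬q = contradiction (P⊆Q p) ¬q
  ... | no _ | yes _ = m≤n⇒m≤1+n (length-filter-⊆ xs)
  ... | no _ | no _ = length-filter-⊆ xs

  length-filter-⊂ : ∀ {x} xs → x ∈ xs → Q x → ¬ P x → suc (length (filter P? xs)) ≤ length (filter Q? xs)
  length-filter-⊂ (x ∷ xs) (here refl) q ¬p with P? x | Q? x
  ... | yes p | _ = contradiction p ¬p
  ... | no _ | yes _ = s≤s (length-filter-⊆ xs)
  ... | no _ | no ¬q = contradiction q ¬q
  length-filter-⊂ (y ∷ xs) (there x∈xs) q ¬p with P? y | Q? y
  ... | yes _ | yes _ = s≤s (length-filter-⊂ xs x∈xs q ¬p)
  ... | yes p | no ¬q = contradiction (P⊆Q p) ¬q
  ... | no _ | yes _ = m≤n⇒m≤1+n (length-filter-⊂ xs x∈xs q ¬p)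
  ... | no _ | no _ = length-filter-⊂ xs x∈xs q ¬p

module _ {A : Set} {P : Pred A 0ℓ} (P? : Decidable P) (f : A → ℕ) where
  sum-map-filter : (∀ x → ¬ P x → f x ≡ 0) → ∀ xs → sum (map f (filter P? xs)) ≡ sum (map f xs)
  sum-map-filter f≡0 [] = refl
  sum-map-filter f≡0 (x ∷ xs) with P? x
  ... | yes _ = cong (f x +_) (sum-map-filter f≡0 xs)
  ... | no ¬p = trans (sum-map-filter f≡0 xs) (cong (_+ sum (map f xs)) (sym (f≡0 x ¬p)))

length≤sum-map : ∀ {A : Set} {f : A → ℕ} {xs} → All (λ x → 1 ≤ f x) xs → length xs ≤ sum (map f xs)
length≤sum-map [] = z≤n
length≤sum-map (p ∷ ps) = +-mono-≤ p (length≤sum-map ps)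

sum-map-+ : ∀ {A : Set} (f g : A → ℕ) xs → sum (map (λ x → f x + g x) xs) ≡ sum (map f xs) + sum (map g xs)
sum-map-+ f g [] = refl
sum-map-+ f g (x ∷ xs) = trans (cong (f x + g x +_) (sum-map-+ f g xs)) (interchange (f x) (g x) (sum (map f xs)) (sum (map g xs)))

sum-map-mono : ∀ {A : Set} {f g : A → ℕ} → (∀ x → f x ≤ g x) → ∀ xs → sum (map f xs) ≤ sum (map g xs)
sum-map-mono f≤g [] = z≤n
sum-map-mono f≤g (x ∷ xs) = +-mono-≤ (f≤g x) (sum-map-mono f≤g xs)

δ : ∀ {n} → Fin n → Fin n → ℕ
δ a t = if does (t ≟ a) then 1 else 0

δ-same : ∀ {n} (a : Fin n) → δ a a ≡ 1
δ-same a = cong (if_then 1 else 0) (dec-true (a ≟ a) refl)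

δ-≢ : ∀ {n} {a t : Fin n} → t ≢ a → δ a t ≡ 0
δ-≢ {a = a} {t} t≢a = cong (if_then 1 else 0) (dec-false (t ≟ a) t≢a)

Σv-suc : ∀ {n} (f : Fin (suc n) → ℕ) → Σv f ≡ f zero + Σv (f ∘ suc)
Σv-suc f = cong (f zero +_) (trans (cong sum (map-tabulate suc f)) (sym (cong sum (map-tabulate id (f ∘ suc)))))

Σv-zero : ∀ {n} → Σv {n} (λ _ → 0) ≡ 0
Σv-zero {zero} = refl
Σv-zero {suc n} = trans (Σv-suc {n} (λ _ → 0)) (Σv-zero {n})

Σv-δ : ∀ {n} (a : Fin n) → Σv (δ a) ≡ 1
Σv-δ {suc n} zero = trans (Σv-suc {n} (δ zero)) (cong suc (Σv-zero {n}))
Σv-δ {suc n} (suc a) = trans (Σv-suc {n} (δ (suc a))) (Σv-δ a)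

Σv-<-by-δ : ∀ {n} {f g : Fin n → ℕ} (a b c : Fin n) →
  (∀ t → f t + (δ a t + δ b t) ≤ g t + δ c t) → Σv f < Σv g
Σv-<-by-δ {n} {f} {g} a b c pointwise = +-cancelʳ-≤ 1 (suc (Σv f)) (Σv g) (begin
  suc (Σv f) + 1                                   ≡⟨ +-suc (Σv f) 1 ⟨
  Σv f + (1 + 1)                                   ≡⟨ cong (Σv f +_) (cong₂ _+_ (Σv-δ a) (Σv-δ b)) ⟨
  Σv f + (Σv (δ a) + Σv (δ b))                     ≡⟨ cong (Σv f +_) (sum-map-+ (δ a) (δ b) (allFin n)) ⟨
  Σv f + Σv (λ t → δ a t + δ b t)                  ≡⟨ sum-map-+ f _ (allFin n) ⟨
  Σv (λ t → f t + (δ a t + δ b t))                 ≤⟨ sum-map-mono pointwise (allFin n) ⟩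
  Σv (λ t → g t + δ c t)                           ≡⟨ sum-map-+ g (δ c) (allFin n) ⟩
  Σv g + Σv (δ c)                                  ≡⟨ cong (Σv g +_) (Σv-δ c) ⟩
  Σv g + 1                                         ∎)
  where open ≤-Reasoning

module _ {n} (u1 : Fin n) (f : Fin n → ℕ) where

  zero-at-or-above : sum (map f (filter (u1 ≤ᶠ?_) (allFin n))) < suc (ell u1) →
    Σ (Fin n) λ z → u1 ≤ᶠ z × f z ≡ 0
  zero-at-or-above lt with any? (λ z → u1 ≤ᶠ? z ×-dec f z ≟ℕ 0)
  ... | yes found = found
  ... | no none = contradiction (begin
      suc (ell u1)                                ≤⟨ length-filter-⊂ (u1 <ᶠ?_) (u1 ≤ᶠ?_) <⇒≤ (allFin n) (∈-allFin u1) ≤-refl (<-irrefl refl) ⟩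
      length (filter (u1 ≤ᶠ?_) (allFin n))         ≤⟨ length≤sum-map (All.map positive (all-filter (u1 ≤ᶠ?_) (allFin n))) ⟩
      sum (map f (filter (u1 ≤ᶠ?_) (allFin n)))    ∎) (<⇒≱ lt)
    where
    open ≤-Reasoning
    positive : ∀ {z} → u1 ≤ᶠ z → 1 ≤ f z
    positive {z} u1≤z = n≢0⇒n>0 (λ fz≡0 → none (z , u1≤z , fz≡0))

  positive-below : sum (map f (filter (u1 ≤ᶠ?_) (allFin n))) < Σv f →
    Σ (Fin n) λ w → w <ᶠ u1 × 1 ≤ f w
  positive-below lt with any? (λ w → w <ᶠ? u1 ×-dec 1 ≤? f w)
  ... | yes found = found
  ... | no none = contradiction lt (<-irrefl (sum-map-filter (u1 ≤ᶠ?_) f vanishes (allFin n)))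
    where
    vanishes : ∀ w → ¬ u1 ≤ᶠ w → f w ≡ 0
    vanishes w u1≰w = n≤0⇒n≡0 (≮⇒≥ (λ 1≤fw → none (w , ≰⇒> u1≰w , 1≤fw)))

-- Edge types and double edge swaps

Matches : ∀ {n} → Fin n → Fin n → Fin n → Fin n → Set
Matches a b x y = (x ≡ a × y ≡ b) ⊎ (x ≡ b × y ≡ a)

matches? : ∀ {n} (a b x y : Fin n) → Dec (Matches a b x y)
matches? a b x y = (x ≟ a ×-dec y ≟ b) ⊎-dec (x ≟ b ×-dec y ≟ a)

ind-matching : ∀ {n} {a b x y : Fin n} → Matches a b x y → ind a b x y ≡ 1
ind-matching {a = a} {b} {x} {y} mt = cong (if_then 1 else 0) (dec-true (matches? a b x y) mt)

ind-¬matching : ∀ {n} {a b x y : Fin n} → ¬ Matches a b x y → ind a b x y ≡ 0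
ind-¬matching {a = a} {b} {x} {y} ¬mt = cong (if_then 1 else 0) (dec-false (matches? a b x y) ¬mt)

ind-self : ∀ {n} (a b : Fin n) → ind a b a b ≡ 1
ind-self a b = ind-matching {a = a} {b} {a} {b} (inj₁ (refl , refl))

ind-self-flip : ∀ {n} (a b : Fin n) → ind a b b a ≡ 1
ind-self-flip a b = ind-matching {a = a} {b} {b} {a} (inj₂ (refl , refl))

ind-cong : ∀ {n} {a b x y c d z w : Fin n} → Matches a b x y ⇔ Matches c d z w →
  ind a b x y ≡ ind c d z w
ind-cong {a = a} {b} {x} {y} {c} {d} {z} {w} eq with matches? a b x y
... | yes mt = trans (ind-matching mt) (sym (ind-matching (Equivalence.to eq mt)))
... | no ¬mt = trans (ind-¬matching ¬mt) (sym (ind-¬matching (¬mt ∘ Equivalence.from eq)))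

Matches-flip : ∀ {n} {a b x y : Fin n} → Matches a b x y → Matches a b y x
Matches-flip (inj₁ (p , q)) = inj₂ (q , p)
Matches-flip (inj₂ (p , q)) = inj₁ (q , p)

Matches-comm : ∀ {n} {a b x y : Fin n} → Matches a b x y → Matches b a x y
Matches-comm (inj₁ pq) = inj₂ pq
Matches-comm (inj₂ pq) = inj₁ pq

ind-flip : ∀ {n} (a b x y : Fin n) → ind a b x y ≡ ind a b y x
ind-flip a b x y = ind-cong {a = a} {b} {x} {y} (mk⇔ Matches-flip Matches-flip)

ind-comm : ∀ {n} (a b x y : Fin n) → ind a b x y ≡ ind b a x y
ind-comm a b x y = ind-cong {a = a} {b} {x} {y} (mk⇔ Matches-comm Matches-comm)

¬Matches-x : ∀ {n} {a b x y : Fin n} → x ≢ a → x ≢ b → ¬ Matches a b x y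
¬Matches-x x≢a x≢b (inj₁ (x≡a , _)) = x≢a x≡a
¬Matches-x x≢a x≢b (inj₂ (x≡b , _)) = x≢b x≡b

¬Matches-y : ∀ {n} {a b x y : Fin n} → y ≢ a → y ≢ b → ¬ Matches a b x y
¬Matches-y y≢a y≢b = ¬Matches-x y≢a y≢b ∘ Matches-flip

¬Matches-a : ∀ {n} {a b x y : Fin n} → a ≢ x → a ≢ y → ¬ Matches a b x y
¬Matches-a a≢x a≢y (inj₁ (x≡a , _)) = a≢x (sym x≡a)
¬Matches-a a≢x a≢y (inj₂ (_ , y≡a)) = a≢y (sym y≡a)

¬Matches-b : ∀ {n} {a b x y : Fin n} → b ≢ x → b ≢ y → ¬ Matches a b x y
¬Matches-b b≢x b≢y = ¬Matches-a b≢x b≢y ∘ Matches-comm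

Matches-unique : ∀ {n} {a b c d x y : Fin n} → Matches a b x y → Matches c d x y → Matches a b c d
Matches-unique (inj₁ (refl , refl)) (inj₁ (refl , refl)) = inj₁ (refl , refl)
Matches-unique (inj₁ (refl , refl)) (inj₂ (refl , refl)) = inj₂ (refl , refl)
Matches-unique (inj₂ (refl , refl)) (inj₁ (refl , refl)) = inj₂ (refl , refl)
Matches-unique (inj₂ (refl , refl)) (inj₂ (refl , refl)) = inj₁ (refl , refl)

SymmetricMult : ∀ {n} → Mult n → Set
SymmetricMult m = ∀ x y → m x y ≡ m y x

Matches⇒≡ : ∀ {n} {m : Mult n} → SymmetricMult m → ∀ {a b x y} → Matches a b x y → m x y ≡ m a b
Matches⇒≡ m-sym (inj₁ (refl , refl)) = refl
Matches⇒≡ m-sym (inj₂ (refl , refl)) = m-sym _ _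

swapG-symmetric : ∀ {n} {m : Mult n} → SymmetricMult m → ∀ a1 a2 a3 a4 → SymmetricMult (swapG a1 a2 a3 a4 m)
swapG-symmetric m-sym a1 a2 a3 a4 x y
  rewrite m-sym x y | ind-flip a1 a2 x y | ind-flip a3 a4 x y | ind-flip a2 a3 x y | ind-flip a4 a1 x y = refl

record Swappable {n} (m : Mult n) (a1 a2 a3 a4 : Fin n) : Set where
  constructor swappable
  field
    edge₁₂ : 1 ≤ m a1 a2
    edge₃₄ : 1 ≤ m a3 a4
    a1≢a2 : a1 ≢ a2
    a3≢a4 : a3 ≢ a4
    a1≢a3 : a1 ≢ a3
    a1≢a4 : a1 ≢ a4
    a2≢a3 : a2 ≢ a3
    a2≢a4 : a2 ≢ a4

swap-admissible : ∀ {n} {m : Mult n} {a1 a2 a3 a4} → Swappable m a1 a2 a3 a4 →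
  2 ≤ m a1 a2 → AdmSwap m (swapG a1 a2 a3 a4 m)
swap-admissible {a1 = a1} {a2} {a3} {a4} sw non-simple =
  a1 , a2 , a3 , a4 , edge₁₂ , edge₃₄ , a1≢a2 , a3≢a4 , a1≢a3 , a1≢a4 , a2≢a3 , a2≢a4 ,
  inj₁ non-simple , λ _ _ → refl
  where open Swappable sw

module _ {n} {m : Mult n} (m-sym : SymmetricMult m) {a1 a2 a3 a4 : Fin n} (sw : Swappable m a1 a2 a3 a4) where
  open Swappable sw

  private
    m' : Mult n
    m' = swapG a1 a2 a3 a4 m

    removed added : Fin n → Fin n → ℕ
    removed x y = ind a1 a2 x y + ind a3 a4 x y
    added x y = ind a2 a3 x y + ind a4 a1 x y

    distinct-removed : ∀ {x y} → Matches a1 a2 x y → ¬ Matches a3 a4 x y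
    distinct-removed mt₁₂ mt₃₄ = ¬Matches-a a1≢a3 a1≢a4 (Matches-unique mt₁₂ mt₃₄)

    removed≤m : ∀ x y → removed x y ≤ m x y
    removed≤m x y with matches? a1 a2 x y | matches? a3 a4 x y
    ... | yes mt₁₂ | _ = begin
      ind a1 a2 x y + ind a3 a4 x y ≡⟨ cong₂ _+_ (ind-matching mt₁₂) (ind-¬matching (distinct-removed mt₁₂)) ⟩
      1                             ≤⟨ edge₁₂ ⟩
      m a1 a2                       ≡⟨ Matches⇒≡ m-sym mt₁₂ ⟨
      m x y                         ∎
      where open ≤-Reasoning
    ... | no ¬mt₁₂ | yes mt₃₄ = begin
      ind a1 a2 x y + ind a3 a4 x y ≡⟨ cong₂ _+_ (ind-¬matching ¬mt₁₂) (ind-matching mt₃₄) ⟩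
      1                             ≤⟨ edge₃₄ ⟩
      m a3 a4                       ≡⟨ Matches⇒≡ m-sym mt₃₄ ⟨
      m x y                         ∎
      where open ≤-Reasoning
    ... | no ¬mt₁₂ | no ¬mt₃₄ = subst (_≤ m x y) (sym (cong₂ _+_ (ind-¬matching ¬mt₁₂) (ind-¬matching ¬mt₃₄))) z≤n

  swapG-conserves : ∀ x y → swapG a1 a2 a3 a4 m x y + (ind a1 a2 x y + ind a3 a4 x y)
                          ≡ m x y + (ind a2 a3 x y + ind a4 a1 x y)
  swapG-conserves x y = begin
    m x y ∸ ind a1 a2 x y ∸ ind a3 a4 x y + ind a2 a3 x y + ind a4 a1 x y + removed x y
      ≡⟨ cong (λ k → k + ind a2 a3 x y + ind a4 a1 x y + removed x y) (∸-+-assoc (m x y) (ind a1 a2 x y) (ind a3 a4 x y)) ⟩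
    m x y ∸ removed x y + ind a2 a3 x y + ind a4 a1 x y + removed x y
      ≡⟨ regroup (m x y ∸ removed x y) (ind a2 a3 x y) (ind a4 a1 x y) (removed x y) ⟩
    m x y ∸ removed x y + removed x y + added x y
      ≡⟨ cong (_+ added x y) (m∸n+n≡m (removed≤m x y)) ⟩
    m x y + added x y ∎
    where
    open ≡-Reasoning
    regroup : ∀ k c d r → k + c + d + r ≡ k + r + (c + d)
    regroup = solve 4 (λ k c d r → k :+ c :+ d :+ r := k :+ r :+ (c :+ d)) refl
      where open +-*-Solver

  swapG-bound : ∀ x y → swapG a1 a2 a3 a4 m x y + ind a1 a2 x y ≤ m x y + (ind a2 a3 x y + ind a4 a1 x y)
  swapG-bound x y = begin
    m' x y + ind a1 a2 x y                     ≤⟨ +-monoʳ-≤ (m' x y) (m≤m+n _ _) ⟩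
    m' x y + removed x y                       ≡⟨ swapG-conserves x y ⟩
    m x y + (ind a2 a3 x y + ind a4 a1 x y) ∎
    where open ≤-Reasoning

  swapG-bound-carry : ∀ {x y} → ¬ Matches a2 a3 x y →
    swapG a1 a2 a3 a4 m x y + ind a1 a2 x y ≤ m x y + ind a1 a4 x y
  swapG-bound-carry {x} {y} ¬mt₂₃ = begin
    m' x y + ind a1 a2 x y                   ≤⟨ swapG-bound x y ⟩
    m x y + (ind a2 a3 x y + ind a4 a1 x y)  ≡⟨ cong (λ k → m x y + (k + ind a4 a1 x y)) (ind-¬matching ¬mt₂₃) ⟩
    m x y + ind a4 a1 x y                    ≡⟨ cong (m x y +_) (ind-comm a4 a1 x y) ⟩
    m x y + ind a1 a4 x y                    ∎
    where open ≤-Reasoning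

  private
    off-added : ∀ {x y} → ¬ Matches a2 a3 x y → ¬ Matches a4 a1 x y → m' x y + ind a1 a2 x y ≤ m x y
    off-added {x} {y} ¬mt₂₃ ¬mt₄₁ = begin
      m' x y + ind a1 a2 x y                   ≤⟨ swapG-bound x y ⟩
      m x y + (ind a2 a3 x y + ind a4 a1 x y)  ≡⟨ cong (m x y +_) (cong₂ _+_ (ind-¬matching ¬mt₂₃) (ind-¬matching ¬mt₄₁)) ⟩
      m x y + 0                                ≡⟨ +-identityʳ _ ⟩
      m x y                                    ∎
      where open ≤-Reasoning

    off-removed : ∀ {x y} → ¬ Matches a1 a2 x y → ¬ Matches a3 a4 x y → m x y + added x y ≡ m' x y
    off-removed {x} {y} ¬mt₁₂ ¬mt₃₄ = begin
      m x y + added x y       ≡⟨ swapG-conserves x y ⟨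
      m' x y + removed x y    ≡⟨ cong (m' x y +_) (cong₂ _+_ (ind-¬matching ¬mt₁₂) (ind-¬matching ¬mt₃₄)) ⟩
      m' x y + 0              ≡⟨ +-identityʳ _ ⟩
      m' x y                  ∎
      where open ≡-Reasoning

  swapG-≤ : ∀ {x y} → ¬ Matches a2 a3 x y → ¬ Matches a4 a1 x y → swapG a1 a2 a3 a4 m x y ≤ m x y
  swapG-≤ ¬mt₂₃ ¬mt₄₁ = ≤-trans (m≤m+n _ _) (off-added ¬mt₂₃ ¬mt₄₁)

  swapG-≥ : ∀ {x y} → ¬ Matches a1 a2 x y → ¬ Matches a3 a4 x y → m x y ≤ swapG a1 a2 a3 a4 m x y
  swapG-≥ ¬mt₁₂ ¬mt₃₄ = ≤-trans (m≤m+n _ _) (≤-reflexive (off-removed ¬mt₁₂ ¬mt₃₄))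

  swapG-removed-< : swapG a1 a2 a3 a4 m a1 a2 < m a1 a2
  swapG-removed-< = begin-strict
    m' a1 a2                    <⟨ m<m+n (m' a1 a2) (s≤s z≤n) ⟩
    m' a1 a2 + 1                ≡⟨ cong (m' a1 a2 +_) (ind-self a1 a2) ⟨
    m' a1 a2 + ind a1 a2 a1 a2  ≤⟨ off-added (¬Matches-x a1≢a2 a1≢a3) (¬Matches-y a2≢a4 (≢-sym a1≢a2)) ⟩
    m a1 a2                     ∎
    where open ≤-Reasoning

  swapG-added-> : m a1 a4 < swapG a1 a2 a3 a4 m a1 a4
  swapG-added-> = begin-strict
    m a1 a4                  <⟨ m<m+n (m a1 a4) (s≤s z≤n) ⟩
    m a1 a4 + 1              ≡⟨ cong (m a1 a4 +_) (ind-self-flip a4 a1) ⟨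
    m a1 a4 + ind a4 a1 a1 a4 ≤⟨ +-monoʳ-≤ (m a1 a4) (m≤n+m _ _) ⟩
    m a1 a4 + added a1 a4    ≡⟨ off-removed (¬Matches-y (≢-sym a1≢a4) (≢-sym a2≢a4)) (¬Matches-x a1≢a3 a1≢a4) ⟩
    m' a1 a4                 ∎
    where open ≤-Reasoning

-- The order on types

AboveType : ∀ {n} → Fin n → Fin n → Fin n → Fin n → Set
AboveType u1 u2 x y = u1 <ᶠ x ⊎ (x ≡ u1 × u2 <ᶠ y)

AboveType-flip : ∀ {n} {u1 u2 x y : Fin n} → x <ᶠ y → AboveType u1 u2 x y → AboveType u1 u2 y x
AboveType-flip x<y (inj₁ u1<x) = inj₁ (<-trans u1<x x<y)
AboveType-flip x<y (inj₂ (refl , _)) = inj₁ x<y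

AboveType⇒¬TypeLe : ∀ {n} {u1 u2 x y : Fin n} → AboveType u1 u2 x y → ¬ TypeLe x y u1 u2
AboveType⇒¬TypeLe (inj₁ u1<x) (inj₁ x<u1) = <-asym u1<x x<u1
AboveType⇒¬TypeLe (inj₁ u1<x) (inj₂ (refl , _)) = <-irrefl refl u1<x
AboveType⇒¬TypeLe (inj₂ (refl , _)) (inj₁ x<u1) = <-irrefl refl x<u1
AboveType⇒¬TypeLe (inj₂ (_ , u2<y)) (inj₂ (_ , y≤u2)) = <⇒≱ u2<y y≤u2

¬AboveType⇒TypeLe : ∀ {n} {u1 u2 x y : Fin n} → ¬ AboveType u1 u2 x y → TypeLe x y u1 u2
¬AboveType⇒TypeLe {u1 = u1} {u2} {x} {y} ¬above with <-cmp x u1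
... | tri< x<u1 _ _ = inj₁ x<u1
... | tri≈ _ x≡u1 _ = inj₂ (x≡u1 , ≮⇒≥ (λ u2<y → ¬above (inj₂ (x≡u1 , u2<y))))
... | tri> _ _ u1<x = contradiction (inj₁ u1<x) ¬above

Below⇒¬AboveType : ∀ {n} {u1 u2 x y : Fin n} → x <ᶠ u1 → ¬ AboveType u1 u2 x y
Below⇒¬AboveType x<u1 above = AboveType⇒¬TypeLe above (inj₁ x<u1)

Below²⇒¬Matches : ∀ {n} {u1 u2 a b x y : Fin n} → a <ᶠ u1 → b <ᶠ u1 → AboveType u1 u2 x y → ¬ Matches a b x y
Below²⇒¬Matches a<u1 b<u1 above (inj₁ (refl , _)) = Below⇒¬AboveType a<u1 above
Below²⇒¬Matches a<u1 b<u1 above (inj₂ (refl , _)) = Below⇒¬AboveType b<u1 above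

SimpleAbove : ∀ {n} → Mult n → Fin n → Fin n → Set
SimpleAbove m u1 u2 = ∀ x y → AboveType u1 u2 x y → m x y ≤ 1

nonSimple⇒TypeLe : ∀ {n} {m : Mult n} {u1 u2 x y} → SimpleAbove m u1 u2 → 2 ≤ m x y → TypeLe x y u1 u2
nonSimple⇒TypeLe {x = x} {y} simple two = ¬AboveType⇒TypeLe (λ above → <⇒≱ two (simple x y above))

maxNonSimple⇒simpleAbove : ∀ {n} {m : Mult n} {u1 u2} → IsMultigraph m → IsMaxNonSimple m u1 u2 → SimpleAbove m u1 u2
maxNonSimple⇒simpleAbove {m = m} (m-sym , loopless) (_ , _ , maximal) x y above = ≮⇒≥ not-two
  where
  not-two : ¬ 1 < m x y
  not-two two with <-cmp x y
  ... | tri< x<y _ _ = AboveType⇒¬TypeLe (AboveType-flip x<y above) (maximal y x x<y (subst (2 ≤_) (m-sym x y) two))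
  ... | tri≈ _ refl _ = <⇒≱ two (subst (_≤ 1) (sym (loopless x)) z≤n)
  ... | tri> _ _ y<x = AboveType⇒¬TypeLe above (maximal x y y<x two)

lessG-intro : ∀ {n} {m m' : Mult n} {u1 u2} → IsMaxNonSimple m u1 u2 →
  m' u1 u2 < m u1 u2 → SimpleAbove m' u1 u2 → LessG m' m
lessG-intro {m' = m'} {u1} {u2} max@(u2<u1 , _ , _) fewer simple with m' u1 u2 ≤? 1
... | yes u1u2-simple = u1 , u2 , max , inj₁ typeLt
  where
  typeLt : ∀ x y → y <ᶠ x → 2 ≤ m' x y → TypeLt x y u1 u2
  typeLt x y _ two with nonSimple⇒TypeLe simple two
  ... | inj₁ x<u1 = inj₁ x<u1
  ... | inj₂ (refl , y≤u2) with y ≟ u2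
  ...   | yes refl = contradiction u1u2-simple (<⇒≱ two)
  ...   | no y≢u2 = inj₂ (refl , ≤∧≢⇒< y≤u2 y≢u2)
... | no u1u2-nonSimple = u1 , u2 , max , inj₂ ((u2<u1 , ≰⇒> u1u2-nonSimple , λ _ _ _ → nonSimple⇒TypeLe simple) , fewer)

module _ {n} {m : Mult n} (m-sym : SymmetricMult m) where

  absent-keeps-simple : ∀ {a b x y} → m a b ≡ 0 → m x y ≤ 1 → m x y + ind a b x y ≤ 1
  absent-keeps-simple {a} {b} {x} {y} ab≡0 xy≤1 with matches? a b x y
  ... | yes mt = ≤-reflexive (cong₂ _+_ (trans (Matches⇒≡ m-sym mt) ab≡0) (ind-matching mt))
  ... | no ¬mt = subst (_≤ 1) (sym (trans (cong (m x y +_) (ind-¬matching ¬mt)) (+-identityʳ _))) xy≤1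

  absent²-keeps-simple : ∀ {a b c d x y} → m a b ≡ 0 → m c d ≡ 0 → ¬ Matches a b c d → m x y ≤ 1 →
    m x y + (ind a b x y + ind c d x y) ≤ 1
  absent²-keeps-simple {a} {b} {c} {d} {x} {y} ab≡0 cd≡0 ¬mt-ab-cd xy≤1 with matches? a b x y
  ... | yes mt = ≤-reflexive (cong₂ _+_ (trans (Matches⇒≡ m-sym mt) ab≡0)
                   (cong₂ _+_ (ind-matching mt) (ind-¬matching (¬mt-ab-cd ∘ Matches-unique mt))))
  ... | no ¬mt = subst (_≤ 1) (cong (m x y +_) (cong (_+ ind c d x y) (sym (ind-¬matching ¬mt))))
                   (absent-keeps-simple cd≡0 xy≤1)

-- The standing setup

module Minimal {n} {m : Mult n} {u1 u2 : Fin n} (multigraph : IsMultigraph m) (degCompatible : DegCompatible m)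
  (maxNonSimple : IsMaxNonSimple m u1 u2) (minimal : ¬ (Σ (Mult n) λ m' → Reach m m' × LessG m' m)) where

  m-sym : SymmetricMult m
  m-sym = proj₁ multigraph

  u2<u1 : u2 <ᶠ u1
  u2<u1 = proj₁ maxNonSimple

  u1≢u2 : u1 ≢ u2
  u1≢u2 = ≢-sym (<⇒≢ u2<u1)

  u1u2-nonSimple : 2 ≤ m u1 u2
  u1u2-nonSimple = proj₁ (proj₂ maxNonSimple)

  u1u2-edge : 1 ≤ m u1 u2
  u1u2-edge = ≤-trans (s≤s z≤n) u1u2-nonSimple

  simpleAbove : SimpleAbove m u1 u2
  simpleAbove = maxNonSimple⇒simpleAbove multigraph maxNonSimple

  edge⇒≢ : ∀ {a b} → 1 ≤ m a b → a ≢ b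
  edge⇒≢ {a} edge refl = <⇒≱ edge (≤-reflexive (proj₂ multigraph a))

  neighbour≢nonNeighbour : ∀ {a b c} → 1 ≤ m a b → m a c ≡ 0 → b ≢ c
  neighbour≢nonNeighbour ab ac≡0 refl = m<n⇒n≢0 ab ac≡0

  ¬improvable : ∀ {m'} → Reach m m' → m' u1 u2 < m u1 u2 → SimpleAbove m' u1 u2 → ⊥
  ¬improvable reach fewer simple = minimal (_ , reach , lessG-intro maxNonSimple fewer simple)

  Harmless : Fin n → Fin n → Set
  Harmless b c = (b <ᶠ u1 × c <ᶠ u1) ⊎ m b c ≡ 0

  harmless-keeps-simple : ∀ {b c d x y} → Harmless b c → m d u1 ≡ 0 → b ≢ d → b ≢ u1 →
    AboveType u1 u2 x y → m x y + (ind b c x y + ind d u1 x y) ≤ 1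
  harmless-keeps-simple {b} {c} {d} {x} {y} (inj₁ (b<u1 , c<u1)) du1≡0 _ _ above = begin
    m x y + (ind b c x y + ind d u1 x y) ≡⟨ cong (λ k → m x y + (k + ind d u1 x y)) (ind-¬matching (Below²⇒¬Matches b<u1 c<u1 above)) ⟩
    m x y + ind d u1 x y                 ≤⟨ absent-keeps-simple m-sym du1≡0 (simpleAbove x y above) ⟩
    1                                    ∎
    where open ≤-Reasoning
  harmless-keeps-simple (inj₂ bc≡0) du1≡0 b≢d b≢u1 above =
    absent²-keeps-simple m-sym bc≡0 du1≡0 (¬Matches-a b≢d b≢u1) (simpleAbove _ _ above)

  -- Swap (u1,u2)(a,b): of the new types, u2a lies below u1 and bu1 is absent from G.
  u1-adjacent₁ : ∀ {a b} → a <ᶠ u1 → a ≢ u2 → b ≢ u1 → b ≢ u2 → 1 ≤ m a b → m u1 b ≢ 0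
  u1-adjacent₁ {a} {b} a<u1 a≢u2 b≢u1 b≢u2 ab u1b≡0 =
    ¬improvable (swap-admissible sw u1u2-nonSimple ◅ ε) (swapG-removed-< m-sym sw) simple
    where
    sw : Swappable m u1 u2 a b
    sw = swappable u1u2-edge ab u1≢u2 (edge⇒≢ ab) (≢-sym (<⇒≢ a<u1)) (≢-sym b≢u1) (≢-sym a≢u2) (≢-sym b≢u2)

    simple : SimpleAbove (swapG u1 u2 a b m) u1 u2
    simple x y above = begin
      swapG u1 u2 a b m x y                  ≤⟨ m≤m+n _ _ ⟩
      swapG u1 u2 a b m x y + ind u1 u2 x y  ≤⟨ swapG-bound-carry m-sym sw (Below²⇒¬Matches u2<u1 a<u1 above) ⟩
      m x y + ind u1 b x y                   ≤⟨ absent-keeps-simple m-sym u1b≡0 (simpleAbove x y above) ⟩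
      1                                      ∎
      where open ≤-Reasoning

  -- Swaps (u1,u2)(a,b), (u1,b)(c,d), with net effect −u1u2 −ab −cd +u2a +bc +du1.
  u1-adjacent₂ : ∀ {a b c d} → a <ᶠ u1 → a ≢ u2 → b ≢ u1 → b ≢ u2 → 1 ≤ m a b → 1 ≤ m u1 b →
    c ≢ u1 → d ≢ u1 → d ≢ u2 → b ≢ c → b ≢ d → 1 ≤ m c d → Harmless b c → m u1 d ≢ 0
  u1-adjacent₂ {a} {b} {c} {d} a<u1 a≢u2 b≢u1 b≢u2 ab u1b c≢u1 d≢u1 d≢u2 b≢c b≢d cd harmless u1d≡0 =
    ¬improvable (swap-admissible sw₁ u1u2-nonSimple ◅ swap-admissible sw₂ u1b-nonSimple₁ ◅ ε) fewer simple
    where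
    u1≢a : u1 ≢ a
    u1≢a = ≢-sym (<⇒≢ a<u1)
    u1≢b : u1 ≢ b
    u1≢b = ≢-sym b≢u1
    u1≢c : u1 ≢ c
    u1≢c = ≢-sym c≢u1
    u1≢d : u1 ≢ d
    u1≢d = ≢-sym d≢u1

    sw₁ : Swappable m u1 u2 a b
    sw₁ = swappable u1u2-edge ab u1≢u2 (edge⇒≢ ab) u1≢a u1≢b (≢-sym a≢u2) (≢-sym b≢u2)

    m₁ : Mult n
    m₁ = swapG u1 u2 a b m
    m₁-sym : SymmetricMult m₁
    m₁-sym = swapG-symmetric m-sym u1 u2 a b

    u1b-nonSimple₁ : 2 ≤ m₁ u1 b
    u1b-nonSimple₁ = ≤-trans (s≤s u1b) (swapG-added-> m-sym sw₁)

    sw₂ : Swappable m₁ u1 b c d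
    sw₂ = swappable (≤-trans (s≤s z≤n) u1b-nonSimple₁)
                    (≤-trans cd (swapG-≥ m-sym sw₁ (¬Matches-a u1≢c u1≢d) (¬Matches-b b≢c b≢d)))
                    u1≢b (edge⇒≢ cd) u1≢c u1≢d b≢c b≢d

    m₂ : Mult n
    m₂ = swapG u1 b c d m₁

    fewer : m₂ u1 u2 < m u1 u2
    fewer = ≤-<-trans (swapG-≤ m₁-sym sw₂ (¬Matches-x u1≢b u1≢c) (¬Matches-a d≢u1 d≢u2))
                      (swapG-removed-< m-sym sw₁)

    simple : SimpleAbove m₂ u1 u2
    simple x y above = ≤-trans
      (+-telescope {b = m₁ x y} (swapG-bound m₁-sym sw₂ x y)
                   (≤-trans (m≤m+n (m₁ x y) _) (swapG-bound-carry m-sym sw₁ (Below²⇒¬Matches u2<u1 a<u1 above))))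
      (harmless-keeps-simple harmless (trans (m-sym d u1) u1d≡0) b≢d b≢u1 above)

  -- Swaps (u1,u2)(x,y), (u1,y)(u2,v), (u1,v)(z,t), with net effect
  -- −u1u2 −xy −u2v −zt +u2x +yu2 +vz +tu1.
  u1-adjacent₃ : ∀ {x y v z t} → x <ᶠ u1 → y <ᶠ u1 → x ≢ u2 → y ≢ u2 → 1 ≤ m x y → 1 ≤ m u1 y →
    v <ᶠ u1 → v ≢ u2 → v ≢ y → 1 ≤ m u2 v → 1 ≤ m u1 v → u1 <ᶠ z →
    t ≢ u1 → t ≢ u2 → t ≢ v → 1 ≤ m z t → m v z ≡ 0 → m u1 t ≢ 0
  u1-adjacent₃ {x} {y} {v} {z} {t} x<u1 y<u1 x≢u2 y≢u2 xy u1y v<u1 v≢u2 v≢y u2v u1v u1<z t≢u1 t≢u2 t≢v zt vz≡0 u1t≡0 =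
    ¬improvable (swap-admissible sw₁ u1u2-nonSimple ◅ swap-admissible sw₂ u1y-nonSimple₁
                 ◅ swap-admissible sw₃ u1v-nonSimple₂ ◅ ε) fewer simple
    where
    u1≢x : u1 ≢ x
    u1≢x = ≢-sym (<⇒≢ x<u1)
    u1≢y : u1 ≢ y
    u1≢y = ≢-sym (<⇒≢ y<u1)
    u1≢v : u1 ≢ v
    u1≢v = ≢-sym (<⇒≢ v<u1)
    u1≢z : u1 ≢ z
    u1≢z = <⇒≢ u1<z
    z≢ : ∀ {a} → a <ᶠ u1 → z ≢ a
    z≢ a<u1 refl = <-asym a<u1 u1<z

    sw₁ : Swappable m u1 u2 x y
    sw₁ = swappable u1u2-edge xy u1≢u2 (edge⇒≢ xy) u1≢x u1≢y (≢-sym x≢u2) (≢-sym y≢u2)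

    m₁ : Mult n
    m₁ = swapG u1 u2 x y m
    m₁-sym : SymmetricMult m₁
    m₁-sym = swapG-symmetric m-sym u1 u2 x y

    u1y-nonSimple₁ : 2 ≤ m₁ u1 y
    u1y-nonSimple₁ = ≤-trans (s≤s u1y) (swapG-added-> m-sym sw₁)

    sw₂ : Swappable m₁ u1 y u2 v
    sw₂ = swappable (≤-trans (s≤s z≤n) u1y-nonSimple₁)
                    (≤-trans u2v (swapG-≥ m-sym sw₁ (¬Matches-y (≢-sym u1≢v) v≢u2) (¬Matches-x (≢-sym x≢u2) (≢-sym y≢u2))))
                    u1≢y (≢-sym v≢u2) u1≢u2 u1≢v y≢u2 (≢-sym v≢y)

    m₂ : Mult n
    m₂ = swapG u1 y u2 v m₁
    m₂-sym : SymmetricMult m₂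
    m₂-sym = swapG-symmetric m₁-sym u1 y u2 v

    u1v-nonSimple₂ : 2 ≤ m₂ u1 v
    u1v-nonSimple₂ = ≤-trans (s≤s (≤-trans u1v (swapG-≥ m-sym sw₁ (¬Matches-y (≢-sym u1≢v) v≢u2) (¬Matches-x u1≢x u1≢y))))
                             (swapG-added-> m₁-sym sw₂)

    sw₃ : Swappable m₂ u1 v z t
    sw₃ = swappable (≤-trans (s≤s z≤n) u1v-nonSimple₂)
                    (≤-trans zt (≤-trans (swapG-≥ m-sym sw₁ (¬Matches-x (≢-sym u1≢z) (z≢ u2<u1)) (¬Matches-x (z≢ x<u1) (z≢ y<u1)))
                                          (swapG-≥ m₁-sym sw₂ (¬Matches-x (≢-sym u1≢z) (z≢ y<u1)) (¬Matches-x (z≢ u2<u1) (z≢ v<u1)))))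
                    u1≢v (edge⇒≢ zt) u1≢z (≢-sym t≢u1) (≢-sym (z≢ v<u1)) (≢-sym t≢v)

    m₃ : Mult n
    m₃ = swapG u1 v z t m₂

    fewer : m₃ u1 u2 < m u1 u2
    fewer = ≤-<-trans (swapG-≤ m₂-sym sw₃ (¬Matches-x u1≢v u1≢z) (¬Matches-a t≢u1 t≢u2))
           (≤-<-trans (swapG-≤ m₁-sym sw₂ (¬Matches-x u1≢y u1≢u2) (¬Matches-a (≢-sym u1≢v) v≢u2))
                      (swapG-removed-< m-sym sw₁))

    simple : SimpleAbove m₃ u1 u2
    simple p q above = ≤-trans
      (+-telescope {b = m₂ p q} (swapG-bound m₂-sym sw₃ p q)
        (+-telescope {b = m₁ p q} (swapG-bound-carry m₁-sym sw₂ (Below²⇒¬Matches y<u1 u2<u1 above))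
                                  (≤-trans (m≤m+n (m₁ p q) _) (swapG-bound-carry m-sym sw₁ (Below²⇒¬Matches u2<u1 x<u1 above)))))
      (harmless-keeps-simple (inj₂ vz≡0) (trans (m-sym t u1) u1t≡0) (≢-sym t≢v) (≢-sym u1≢v) above)

  -- Otherwise m z t ≤ m u1 t for t ∉ {u1,v,u2}, edges at z being simple as z > u1; v and u2
  -- give deg u1 two more and u1 gives deg z at most one more, so deg z < deg u1 although u1 < z.
  private-neighbour : ∀ {v z} → v ≢ u1 → v ≢ u2 → 1 ≤ m u1 v → u1 <ᶠ z → m z v ≡ 0 →
    Σ (Fin n) λ t → 1 ≤ m z t × t ≢ u1 × m u1 t ≡ 0
  private-neighbour {v} {z} v≢u1 v≢u2 u1v u1<z zv≡0
    with any? (λ t → 1 ≤? m z t ×-dec (¬? (t ≟ u1) ×-dec m u1 t ≟ℕ 0))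
  ... | yes found = found
  ... | no none = contradiction (degCompatible z u1 (Σv-<-by-δ v u2 u1 dominated)) (<-asym u1<z)
    where
    zt≤1 : ∀ t → m z t ≤ 1
    zt≤1 t = simpleAbove z t (inj₁ u1<z)

    dominated-elsewhere : ∀ {t} → t ≢ u1 → m z t ≤ m u1 t
    dominated-elsewhere {t} t≢u1 with 1 ≤? m z t
    ... | yes zt = ≤-trans (zt≤1 t) (n≢0⇒n>0 (λ u1t≡0 → none (t , zt , t≢u1 , u1t≡0)))
    ... | no ¬zt = ≤-trans (≮⇒≥ ¬zt) z≤n

    dominated : ∀ t → m z t + (δ v t + δ u2 t) ≤ m u1 t + δ u1 t
    -- Deciding u1 ≟ t rather than t ≟ u1 keeps the with-abstraction out of δ u1 t.
    dominated t with u1 ≟ t | v ≟ t | u2 ≟ t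
    ... | yes refl | _ | _
      rewrite δ-≢ (≢-sym v≢u1) | δ-≢ u1≢u2 | δ-same u1 | proj₂ multigraph u1 | +-identityʳ (m z u1) = zt≤1 u1
    ... | no u1≢t | yes refl | _
      rewrite zv≡0 | δ-same v | δ-≢ v≢u2 | δ-≢ v≢u1 | +-identityʳ (m u1 v) = u1v
    ... | no u1≢t | no v≢t | yes refl
      rewrite δ-≢ (≢-sym v≢u2) | δ-same u2 | δ-≢ (≢-sym u1≢u2) | +-identityʳ (m u1 u2) = ≤-trans (+-monoˡ-≤ 1 (zt≤1 u2)) u1u2-nonSimple
    ... | no u1≢t | no v≢t | no u2≢t
      rewrite δ-≢ (≢-sym v≢t) | δ-≢ (≢-sym u2≢t) | δ-≢ (≢-sym u1≢t) | +-identityʳ (m z t) | +-identityʳ (m u1 t) =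
        dominated-elsewhere (≢-sym u1≢t)

  module SmallEdge {x y} (x<u1 : x <ᶠ u1) (x≢u2 : x ≢ u2) (y<u1 : y <ᶠ u1) (y≢u2 : y ≢ u2) (xy : 1 ≤ m x y) where

    u1y : 1 ≤ m u1 y
    u1y = n≢0⇒n>0 (u1-adjacent₁ x<u1 x≢u2 (<⇒≢ y<u1) y≢u2 xy)

    low-neighbour⇒u1-adjacent : ∀ {v w} → v <ᶠ u1 → v ≢ u2 → w <ᶠ u1 → 1 ≤ m v w → m u1 v ≢ 0
    low-neighbour⇒u1-adjacent {v} {w} v<u1 v≢u2 w<u1 vw u1v≡0 with w ≟ u2
    ... | no w≢u2 = u1-adjacent₁ w<u1 w≢u2 (<⇒≢ v<u1) v≢u2 (subst (1 ≤_) (m-sym v w) vw) u1v≡0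
    ... | yes refl = u1-adjacent₂ x<u1 x≢u2 (<⇒≢ y<u1) y≢u2 xy u1y (<⇒≢ u2<u1) (<⇒≢ v<u1) v≢u2 y≢u2 (neighbour≢nonNeighbour u1y u1v≡0)
                       (subst (1 ≤_) (m-sym v w) vw) (inj₁ (y<u1 , u2<u1)) u1v≡0

    low-neighbour⇒adjacent-above : ∀ {v w z} → v <ᶠ u1 → v ≢ u2 → w <ᶠ u1 → 1 ≤ m v w → u1 ≤ᶠ z → m v z ≢ 0
    low-neighbour⇒adjacent-above {v} {w} {z} v<u1 v≢u2 w<u1 vw u1≤z vz≡0 =
      let t , zt , t≢u1 , u1t≡0 = private-neighbour (<⇒≢ v<u1) v≢u2 u1v u1<z zv≡0
      in conclude zt t≢u1 u1t≡0 (≢-sym (neighbour≢nonNeighbour u1u2-edge u1t≡0)) (neighbour≢nonNeighbour zt zv≡0)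
      where
      zv≡0 : m z v ≡ 0
      zv≡0 = trans (m-sym z v) vz≡0

      u1v : 1 ≤ m u1 v
      u1v = n≢0⇒n>0 (low-neighbour⇒u1-adjacent v<u1 v≢u2 w<u1 vw)

      u1<z : u1 <ᶠ z
      u1<z = ≤∧≢⇒< u1≤z (neighbour≢nonNeighbour (subst (1 ≤_) (m-sym u1 v) u1v) vz≡0)

      v≢z : v ≢ z
      v≢z refl = <-asym v<u1 u1<z

      wv : 1 ≤ m w v
      wv = subst (1 ≤_) (m-sym v w) vw

      conclude : ∀ {t} → 1 ≤ m z t → t ≢ u1 → m u1 t ≡ 0 → t ≢ u2 → t ≢ v → ⊥
      conclude zt t≢u1 u1t≡0 t≢u2 t≢v with w ≟ u2 | v ≟ y
      ... | no w≢u2 | _ =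
        u1-adjacent₂ w<u1 w≢u2 (<⇒≢ v<u1) v≢u2 wv u1v (≢-sym (<⇒≢ u1<z)) t≢u1 t≢u2 v≢z (≢-sym t≢v) zt (inj₂ vz≡0) u1t≡0
      ... | yes refl | yes refl =
        u1-adjacent₂ x<u1 x≢u2 (<⇒≢ y<u1) y≢u2 xy u1y (≢-sym (<⇒≢ u1<z)) t≢u1 t≢u2 v≢z (≢-sym t≢v) zt (inj₂ vz≡0) u1t≡0
      ... | yes refl | no v≢y =
        u1-adjacent₃ x<u1 y<u1 x≢u2 y≢u2 xy u1y v<u1 v≢u2 v≢y wv u1v u1<z t≢u1 t≢u2 t≢v zt vz≡0 u1t≡0

lemma5p9 : ∀ {n} (m : Mult n) (u1 u2 : Fin n) →
    IsMultigraph m →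
    DegCompatible m →
    IsMaxNonSimple m u1 u2 →
    ¬ (Σ (Mult n) λ m' → Reach m m' × LessG m' m) →
    (Σ (Fin n) λ x → Σ (Fin n) λ y → Small u1 u2 x × Small u1 u2 y × 1 ≤ m x y) →
    ∀ v → Small u1 u2 v → suc (ell u1) ⊓ deg m v ≤ edgesToLu1 m u1 v
lemma5p9 m u1 u2 multigraph degCompatible maxNonSimple minimal
         (x , y , (_ , x≢u2 , x<u1) , (_ , y≢u2 , y<u1) , xy) v (_ , v≢u2 , v<u1) =
  ≮⇒≥ λ deficient →
    let z , u1≤z , vz≡0 = zero-at-or-above u1 (m v) (m<n⊓o⇒m<n _ _ deficient)
        w , w<u1 , vw = positive-below u1 (m v) (m<n⊓o⇒m<o _ _ deficient)
    in low-neighbour⇒adjacent-above v<u1 v≢u2 w<u1 vw u1≤z vz≡0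
  where
  open Minimal multigraph degCompatible maxNonSimple minimal
  open SmallEdge x<u1 x≢u2 y<u1 y≢u2 xy
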